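{- Let $d\ge1$, $n>d$, let $T\in L(n,d)$, let $T_1\in T$, and let $T'=T\setminus\{T_1\}$. Then the product poset $\mathcal{I}_{n,d}(\{T_1\})\times\mathcal{I}_{n,d}(T')$ and the poset $\mathcal{I}_{n,d}(T)$ are isomorphic as posets.
   Context: For a finite set $X$ put $\operatorname{codim}_d(X)=d+1-|X|$. For a finite collection $\{T_1,\dots,T_l\}$ of pairwise distinct finite sets put $\rho_d(\{T_1,\dots,T_l\})=\sum_{i=1}^l\operatorname{codim}_d(T_i)$ (with $\rho_d(\emptyset)=0$) and $D_d(\{T_1,\dots,T_l\})=\operatorname{codim}_d(T_1\cap\cdots\cap T_l)-\rho_d(\{T_1,\dots,T_l\})$. For integers $d\ge1$, $n>d$, let $L(n,d)$ be the set of all $T\subset 2^{\{1,\dots,n\}}$ such that (1) $D_d(T')>0$ for every $T'\subset T$ with $|T'|>1$, and (2) $0\le |T_i|\le d$ for every $T_i\in T$. It is partially ordered by: $T<T'$ iff $\rho_d(T)<\rho_d(T')$ and for every $T_i\in T$ there exists $T'_j\in T'$ with $T'_j\subset T_i$; $T\le T'$ means $T<T'$ or $T=T'$. For $T\in L(n,d)$, $\mathcal{I}_{n,d}(T)=\{S\in L(n,d): S\le T\}$; the product of posets carries the componentwise order. -}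

module Defs where

open import Data.Nat as ℕ using (ℕ; suc)
open import Data.Integer as ℤ using (ℤ; +_; _-_; _+_; 0ℤ)
open import Data.Fin.Subset using (Subset; _⊆_; _∩_; ⊤; ∣_∣)
open import Data.Bool.Properties using () renaming (_≟_ to _≟B_)
open import Data.Vec.Properties using (≡-dec)
open import Data.List using (List; []; _∷_; [_]; length; filter; foldr; map; sum)
open import Data.List.Relation.Unary.All using (All)
open import Data.List.Relation.Unary.Unique.Propositional using (Unique)
open import Data.List.Membership.Propositional using (_∈_; _∉_)
open import Data.Product using (Σ; ∃; _×_; _,_; proj₁)
open import Data.Sum using (_⊎_)
open import Relation.Nullary using (¬?)
open import Relation.Binary.PropositionalEquality using (_≡_)

-- A finite collection of subsets of {1..n} (here Fin n), represented as a
-- duplicate-free list (Unique is imposed in the definition of L).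
Coll : ℕ → Set
Coll n = List (Subset n)

_≈C_ : ∀ {n} → Coll n → Coll n → Set
S ≈C S' = ∀ X → (X ∈ S → X ∈ S') × (X ∈ S' → X ∈ S)

codim : ∀ {n} → ℕ → Subset n → ℤ
codim d X = + (suc d) - + ∣ X ∣

ρ : ∀ {n} → ℕ → Coll n → ℤ
ρ d T = foldr (λ X r → codim d X + r) 0ℤ T

⋂ : ∀ {n} → Coll n → Subset n
⋂ T = foldr _∩_ ⊤ T

D : ∀ {n} → ℕ → Coll n → ℤ
D d T = codim d (⋂ T) - ρ d T

InL : (n d : ℕ) → Coll n → Set
InL n d T =
  Unique T
  × (∀ (T' : Coll n) → Unique T' → All (_∈ T) T' → 2 ℕ.≤ length T' → 0ℤ ℤ.< D d T')
  × All (λ X → ∣ X ∣ ℕ.≤ d) T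

_<[_]_ : ∀ {n} → Coll n → ℕ → Coll n → Set
T <[ d ] T' = (ρ d T ℤ.< ρ d T') × (∀ X → X ∈ T → ∃ λ Y → Y ∈ T' × Y ⊆ X)

_≤[_]_ : ∀ {n} → Coll n → ℕ → Coll n → Set
T ≤[ d ] T' = (T <[ d ] T') ⊎ (T ≈C T')

I : (n d : ℕ) → Coll n → Set
I n d T = Σ (Coll n) λ S → InL n d S × S ≤[ d ] T

_∖_ : ∀ {n} → Coll n → Subset n → Coll n
T ∖ X = filter (λ Y → ¬? (≡-dec _≟B_ Y X)) T

record PosetData : Set₁ where
  constructor mkPD
  field
    Car : Set
    _≈_ : Car → Car → Set
    _≤_ : Car → Car → Set

Ipd : (n d : ℕ) → Coll n → PosetData
Ipd n d T = mkPD (I n d T) (λ a b → proj₁ a ≈C proj₁ b) (λ a b → proj₁ a ≤[ d ] proj₁ b)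

_×P_ : PosetData → PosetData → PosetData
P ×P Q = mkPD (PosetData.Car P × PosetData.Car Q)
  (λ { (a , b) (a' , b') → PosetData._≈_ P a a' × PosetData._≈_ Q b b' })
  (λ { (a , b) (a' , b') → PosetData._≤_ P a a' × PosetData._≤_ Q b b' })

record PosetIso (P Q : PosetData) : Set where
  open PosetData P renaming (Car to A; _≈_ to _≈₁_; _≤_ to _≤₁_)
  open PosetData Q renaming (Car to B; _≈_ to _≈₂_; _≤_ to _≤₂_)
  field
    to      : A → B
    from    : B → A
    to-cong   : ∀ {a a'} → a ≈₁ a' → to a ≈₂ to a'
    from-cong : ∀ {b b'} → b ≈₂ b' → from b ≈₁ from b'
    from∘to : ∀ a → from (to a) ≈₁ a
    to∘from : ∀ b → to (from b) ≈₂ b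
    to-mono   : ∀ {a a'} → a ≤₁ a' → to a ≤₂ to a'
    to-reflect : ∀ {a a'} → to a ≤₂ to a' → a ≤₁ a'

module Submission where

-- The isomorphism sends a pair
-- (S₁, S₂) to the union S₁ ∪ S₂, and S to the pair (members of S containing
-- T₁, remaining members of S).  Three facts make this work.
--  (1) Refinement criterion: for S ∈ L(n,d) and W with members of size ≤ d,
--      S ≤ W holds iff every member of S contains a member of W.  The
--      nontrivial direction is ρ(S) ≤ ρ(W), with equality only if S = W; it
--      is proved by grouping the members of S above the members of W.
--  (2) Separation: two distinct members Y, Y' of T never lie in a common set
--      of size ≤ d, since D({Y, Y'}) = |Y ∪ Y'| - (d + 1) > 0.
--  (3) Union lemma: S₁ ∪ S₂ satisfies the D-condition.  A subfamily U mixing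
--      both parts is compared with the family V ⊆ T of members of T that the
--      members of U lie above; inclusion–exclusion gives D(V) ≤ D(U), and V
--      contains T₁ and another member of T, so D(V) > 0.
-- The file proves auxiliary facts on finite sets, integers and lists, then
-- the algebra of codim/ρ/D, (1), the comparison D(V) ≤ D(U) used in (3), and
-- finally (2), (3) and the isomorphism for fixed T and T₁.

open import Defs
open import Level using (0ℓ)
open import Data.Nat as ℕ using (ℕ; suc; z≤n; s≤s; _≤_; _<_)
import Data.Nat.Properties as ℕP
open import Data.Integer as ℤ using (ℤ; +_; _-_; _+_; 0ℤ; -_)
import Data.Integer.Properties as ℤP
open import Data.Integer.Tactic.RingSolver using (solve-∀)
open import Data.Bool using (true; false)
open import Data.Bool.Properties using () renaming (_≟_ to _≟B_)
open import Data.Vec using ([]; _∷_; here)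
open import Data.Vec.Properties using (≡-dec)
open import Data.Fin.Subset using (Subset; _⊆_; _∩_; _∪_; ∣_∣; ⊤)
open import Data.Fin.Subset.Properties
  using (drop-∷-⊆; p⊆q⇒∣p∣≤∣q∣; _⊆?_; ⊆-refl; ⊆-trans; ⊆⊤; p∩q⊆p; p∩q⊆q;
         x∈p∩q⁺; x∈p∪q⁺; x∈p∪q⁻; ∩-assoc; ∩-comm; ∩-identityˡ; ∩-identityʳ)
open import Data.Empty using (⊥; ⊥-elim)
open import Data.Sum using (_⊎_; inj₁; inj₂)
open import Data.Product using (_×_; _,_; proj₁; proj₂; ∃)
open import Data.List using (List; []; _∷_; [_]; length; filter; _++_)
open import Data.List.Relation.Unary.All as All using (All; []; _∷_; all?)
import Data.List.Relation.Unary.All.Properties as AllP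
open import Data.List.Relation.Unary.Any using (here; there; any?)
open import Data.List.Relation.Unary.AllPairs using ([]; _∷_)
open import Data.List.Relation.Unary.Unique.Propositional using (Unique)
import Data.List.Relation.Unary.Unique.Propositional.Properties as UniqueP
open import Data.List.Membership.Propositional using (_∈_; find)
open import Data.List.Membership.Propositional.Properties
  using (∈-filter⁺; ∈-filter⁻; ∈-++⁺ˡ; ∈-++⁺ʳ; ∈-++⁻)
open import Data.List.Relation.Binary.Subset.Propositional.Properties using (filter-⊆)
open import Relation.Nullary using (¬_; ¬?; yes; no)
open import Relation.Unary using (Decidable; Pred; ∁)
open import Relation.Unary.Properties using (∁?)
open import Relation.Binary.PropositionalEquality
  using (_≡_; refl; sym; trans; cong; cong₂; subst; subst₂)

∣p∩q∣+∣p∪q∣≡∣p∣+∣q∣ : ∀ {m} (p q : Subset m) → ∣ p ∩ q ∣ ℕ.+ ∣ p ∪ q ∣ ≡ ∣ p ∣ ℕ.+ ∣ q ∣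
∣p∩q∣+∣p∪q∣≡∣p∣+∣q∣ [] [] = refl
∣p∩q∣+∣p∪q∣≡∣p∣+∣q∣ (true ∷ p) (true ∷ q) =
  cong suc (trans (ℕP.+-suc _ _) (trans (cong suc (∣p∩q∣+∣p∪q∣≡∣p∣+∣q∣ p q)) (sym (ℕP.+-suc _ _))))
∣p∩q∣+∣p∪q∣≡∣p∣+∣q∣ (true ∷ p) (false ∷ q) =
  trans (ℕP.+-suc _ _) (cong suc (∣p∩q∣+∣p∪q∣≡∣p∣+∣q∣ p q))
∣p∩q∣+∣p∪q∣≡∣p∣+∣q∣ (false ∷ p) (true ∷ q) =
  trans (ℕP.+-suc _ _) (trans (cong suc (∣p∩q∣+∣p∪q∣≡∣p∣+∣q∣ p q)) (sym (ℕP.+-suc _ _)))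
∣p∩q∣+∣p∪q∣≡∣p∣+∣q∣ (false ∷ p) (false ∷ q) = ∣p∩q∣+∣p∪q∣≡∣p∣+∣q∣ p q

⊆∧∣≡∣⇒≡ : ∀ {m} {p q : Subset m} → p ⊆ q → ∣ p ∣ ≡ ∣ q ∣ → p ≡ q
⊆∧∣≡∣⇒≡ {p = []} {[]} _ _ = refl
⊆∧∣≡∣⇒≡ {p = true ∷ p} {true ∷ q} p⊆q e = cong (true ∷_) (⊆∧∣≡∣⇒≡ (drop-∷-⊆ p⊆q) (ℕP.suc-injective e))
⊆∧∣≡∣⇒≡ {p = true ∷ p} {false ∷ q} p⊆q _ with p⊆q here
... | ()
⊆∧∣≡∣⇒≡ {p = false ∷ p} {true ∷ q} p⊆q e =
  ⊥-elim (ℕP.<-irrefl refl (subst (ℕ._≤ ∣ q ∣) e (p⊆q⇒∣p∣≤∣q∣ (drop-∷-⊆ p⊆q))))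
⊆∧∣≡∣⇒≡ {p = false ∷ p} {false ∷ q} p⊆q e = cong (false ∷_) (⊆∧∣≡∣⇒≡ (drop-∷-⊆ p⊆q) e)

∪-mono : ∀ {m} {p p' q q' : Subset m} → p ⊆ p' → q ⊆ q' → p ∪ q ⊆ p' ∪ q'
∪-mono {p = p} {q = q} p⊆p' q⊆q' x with x∈p∪q⁻ p q x
... | inj₁ x∈p = x∈p∪q⁺ (inj₁ (p⊆p' x∈p))
... | inj₂ x∈q = x∈p∪q⁺ (inj₂ (q⊆q' x∈q))

∪-least : ∀ {m} {p q r : Subset m} → p ⊆ r → q ⊆ r → p ∪ q ⊆ r
∪-least {p = p} {q} p⊆r q⊆r x with x∈p∪q⁻ p q x
... | inj₁ x∈p = p⊆r x∈p
... | inj₂ x∈q = q⊆r x∈q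

∩-greatest : ∀ {m} {r p q : Subset m} → r ⊆ p → r ⊆ q → r ⊆ p ∩ q
∩-greatest r⊆p r⊆q x = x∈p∩q⁺ (r⊆p x , r⊆q x)

0<i-j⇒j<i : ∀ {i j : ℤ} → 0ℤ ℤ.< i - j → j ℤ.< i
0<i-j⇒j<i {i} {j} h = subst₂ ℤ._<_ (ℤP.+-identityˡ j) (lemma i j) (ℤP.+-monoˡ-< j h)
  where
  lemma : ∀ i j → i - j + j ≡ i
  lemma = solve-∀

j<i⇒0<i-j : ∀ {i j : ℤ} → j ℤ.< i → 0ℤ ℤ.< i - j
j<i⇒0<i-j {i} {j} h = subst (ℤ._< i - j) (ℤP.+-inverseʳ j) (ℤP.+-monoˡ-< (- j) h)

≤⇒<⊎≡ : ∀ {i j : ℤ} → i ℤ.≤ j → (i ℤ.< j) ⊎ (i ≡ j)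
≤⇒<⊎≡ {i} {j} i≤j with i ℤP.≟ j
... | yes i≡j = inj₂ i≡j
... | no i≢j = inj₁ (ℤP.≤∧≢⇒< i≤j i≢j)

+-tight : ∀ {a A b B : ℤ} → a ℤ.≤ A → b ℤ.≤ B → a + b ≡ A + B → (a ≡ A) × (b ≡ B)
+-tight a≤A b≤B e with ≤⇒<⊎≡ a≤A | ≤⇒<⊎≡ b≤B
... | inj₁ a<A | _ = ⊥-elim (ℤP.<⇒≢ (ℤP.+-mono-<-≤ a<A b≤B) e)
... | inj₂ _ | inj₁ b<B = ⊥-elim (ℤP.<⇒≢ (ℤP.+-mono-≤-< a≤A b<B) e)
... | inj₂ a≡A | inj₂ b≡B = a≡A , b≡B

-- Monotonicity in the shape of the splitting formulas for D below.
split-mono : ∀ {dv du e p q s : ℤ} → 0ℤ ℤ.≤ e → dv ℤ.≤ du → p ℤ.≤ q →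
             dv + p - s ℤ.≤ e + du + q - s
split-mono {dv} {du} {e} {p} {q} {s} 0≤e dv≤du p≤q =
  ℤP.+-monoˡ-≤ (- s) (ℤP.+-mono-≤ (subst (ℤ._≤ e + du) (ℤP.+-identityˡ dv) (ℤP.+-mono-≤ 0≤e dv≤du)) p≤q)

distinct∈⇒2≤length : ∀ {A : Set} {x y : A} {xs : List A} → x ∈ xs → y ∈ xs → ¬ x ≡ y → 2 ≤ length xs
distinct∈⇒2≤length {xs = _ ∷ []} (here refl) (here refl) x≢y = ⊥-elim (x≢y refl)
distinct∈⇒2≤length {xs = _ ∷ _ ∷ _} _ _ _ = s≤s (s≤s z≤n)

trichotomy : ∀ {A : Set} {P : Pred A 0ℓ} (P? : Decidable P) (xs : List A) →
  All P xs ⊎ All (∁ P) xs ⊎ ((∃ λ x → x ∈ xs × P x) × (∃ λ x → x ∈ xs × ¬ P x))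
trichotomy P? xs with all? P? xs | any? P? xs
... | yes all | _ = inj₁ all
... | no _ | no none = inj₂ (inj₁ (AllP.¬Any⇒All¬ xs none))
... | no notAll | yes some = inj₂ (inj₂ (find some , find (AllP.¬All⇒Any¬ P? xs notAll)))

≈C-reflexive : ∀ {n} {A B : Coll n} → A ≡ B → A ≈C B
≈C-reflexive refl _ = (λ x → x) , (λ x → x)

≈C-sym : ∀ {n} {A B : Coll n} → A ≈C B → B ≈C A
≈C-sym A≈B X = proj₂ (A≈B X) , proj₁ (A≈B X)

≈C-trans : ∀ {n} {A B C : Coll n} → A ≈C B → B ≈C C → A ≈C C
≈C-trans A≈B B≈C X = (λ x → proj₁ (B≈C X) (proj₁ (A≈B X) x)) , (λ x → proj₂ (A≈B X) (proj₂ (B≈C X) x))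

++-cong : ∀ {n} {A A' B B' : Coll n} → A ≈C A' → B ≈C B' → (A ++ B) ≈C (A' ++ B')
++-cong {A = A} {A'} A≈A' B≈B' X = to , from
  where
  to : X ∈ A ++ _ → X ∈ A' ++ _
  to x with ∈-++⁻ A x
  ... | inj₁ x∈A = ∈-++⁺ˡ (proj₁ (A≈A' X) x∈A)
  ... | inj₂ x∈B = ∈-++⁺ʳ A' (proj₁ (B≈B' X) x∈B)
  from : X ∈ A' ++ _ → X ∈ A ++ _
  from x with ∈-++⁻ A' x
  ... | inj₁ x∈A' = ∈-++⁺ˡ (proj₂ (A≈A' X) x∈A')
  ... | inj₂ x∈B' = ∈-++⁺ʳ A (proj₂ (B≈B' X) x∈B')

filter-cong : ∀ {n} {P : Pred (Subset n) 0ℓ} (P? : Decidable P) {A A' : Coll n} →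
  A ≈C A' → filter P? A ≈C filter P? A'
filter-cong P? A≈A' X =
  (λ x → let (x∈A , px) = ∈-filter⁻ P? x in ∈-filter⁺ P? (proj₁ (A≈A' X) x∈A) px) ,
  (λ x → let (x∈A' , px) = ∈-filter⁻ P? x in ∈-filter⁺ P? (proj₂ (A≈A' X) x∈A') px)

filter-partition : ∀ {n} {P : Pred (Subset n) 0ℓ} (P? : Decidable P) (S : Coll n) →
  S ≈C (filter P? S ++ filter (∁? P?) S)
filter-partition P? S X = to , from
  where
  to : X ∈ S → X ∈ filter P? S ++ filter (∁? P?) S
  to x with P? X
  ... | yes px = ∈-++⁺ˡ (∈-filter⁺ P? x px)
  ... | no ¬px = ∈-++⁺ʳ (filter P? S) (∈-filter⁺ (∁? P?) x ¬px)
  from : X ∈ filter P? S ++ filter (∁? P?) S → X ∈ S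
  from x with ∈-++⁻ (filter P? S) x
  ... | inj₁ x∈F = filter-⊆ P? S x∈F
  ... | inj₂ x∈G = filter-⊆ (∁? P?) S x∈G

module Families (n d : ℕ) where

  Sized : Coll n → Set
  Sized S = All (λ X → ∣ X ∣ ≤ d) S

  Good : Coll n → Set
  Good S = ∀ (U : Coll n) → Unique U → All (_∈ S) U → 2 ≤ length U → 0ℤ ℤ.< D d U

  Refines : Coll n → Coll n → Set
  Refines S W = ∀ X → X ∈ S → ∃ λ Y → Y ∈ W × Y ⊆ X

  s : ℤ
  s = + suc d

  above? : (Y : Subset n) → Decidable (Y ⊆_)
  above? Y X = Y ⊆? X

  good-⊆ : ∀ {S S'} → Good S → (∀ {X} → X ∈ S' → X ∈ S) → Good S'
  good-⊆ g S'⊆S U u U⊆S' len = g U u (All.map S'⊆S U⊆S') len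

  InL-filter : ∀ {S} {P : Pred (Subset n) 0ℓ} (P? : Decidable P) → InL n d S → InL n d (filter P? S)
  InL-filter {S} P? (u , g , sized) = UniqueP.filter⁺ P? u , good-⊆ g (filter-⊆ P? S) , AllP.filter⁺ P? sized

  Refines-++ : ∀ {A A' B B'} → Refines A A' → Refines B B' → Refines (A ++ B) (A' ++ B')
  Refines-++ {A} {A'} rA rB X x with ∈-++⁻ A x
  ... | inj₁ x∈A = let (Y , y , Y⊆X) = rA X x∈A in Y , ∈-++⁺ˡ y , Y⊆X
  ... | inj₂ x∈B = let (Y , y , Y⊆X) = rB X x∈B in Y , ∈-++⁺ʳ A' y , Y⊆X

  ⊆-⋂ : ∀ {Y} (U : Coll n) → All (Y ⊆_) U → Y ⊆ ⋂ U
  ⊆-⋂ [] [] = ⊆⊤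
  ⊆-⋂ (X ∷ U) (Y⊆X ∷ Y⊆U) = ∩-greatest Y⊆X (⊆-⋂ U Y⊆U)

  ⋂⊆member : ∀ {X} (U : Coll n) → X ∈ U → ⋂ U ⊆ X
  ⋂⊆member (Y ∷ U) (here refl) = p∩q⊆p Y (⋂ U)
  ⋂⊆member (Y ∷ U) (there x) = ⊆-trans (p∩q⊆q Y (⋂ U)) (⋂⊆member U x)

  Refines⇒⋂⊆⋂ : ∀ (U V : Coll n) → Refines U V → ⋂ V ⊆ ⋂ U
  Refines⇒⋂⊆⋂ [] V r = ⊆⊤
  Refines⇒⋂⊆⋂ (X ∷ U) V r =
    let (Y , y , Y⊆X) = r X (here refl)
    in ∩-greatest (⊆-trans (⋂⊆member V y) Y⊆X) (Refines⇒⋂⊆⋂ U V (λ Z z → r Z (there z)))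

  -- Splitting a collection by a predicate splits ⋂, ρ and, by
  -- inclusion–exclusion, D:  D(U) = D(F) + D(G) + |⋂F ∪ ⋂G| - (d + 1).
  ⋂-filter-split : ∀ {P : Pred (Subset n) 0ℓ} (P? : Decidable P) (U : Coll n) →
    ⋂ U ≡ ⋂ (filter P? U) ∩ ⋂ (filter (∁? P?) U)
  ⋂-filter-split P? [] = sym (∩-identityˡ ⊤)
  ⋂-filter-split P? (X ∷ U) with P? X
  ... | yes _ = trans (cong (X ∩_) (⋂-filter-split P? U)) (sym (∩-assoc X _ _))
  ... | no _ = trans (cong (X ∩_) (⋂-filter-split P? U)) (swap X _ _)
    where
    swap : ∀ x a b → x ∩ (a ∩ b) ≡ a ∩ (x ∩ b)
    swap x a b = trans (sym (∩-assoc x a b)) (trans (cong (_∩ b) (∩-comm x a)) (∩-assoc a x b))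

  ρ-filter-split : ∀ {P : Pred (Subset n) 0ℓ} (P? : Decidable P) (U : Coll n) →
    ρ d U ≡ ρ d (filter P? U) + ρ d (filter (∁? P?) U)
  ρ-filter-split P? [] = refl
  ρ-filter-split P? (X ∷ U) with P? X
  ... | yes _ = trans (cong (λ r → codim d X + r) (ρ-filter-split P? U)) (assoc (codim d X) ρF ρG)
    where
    ρF = ρ d (filter P? U)
    ρG = ρ d (filter (∁? P?) U)
    assoc : ∀ x a b → x + (a + b) ≡ (x + a) + b
    assoc = solve-∀
  ... | no _ = trans (cong (λ r → codim d X + r) (ρ-filter-split P? U)) (swap (codim d X) ρF ρG)
    where
    ρF = ρ d (filter P? U)
    ρG = ρ d (filter (∁? P?) U)
    swap : ∀ x a b → x + (a + b) ≡ a + (x + b)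
    swap = solve-∀

  codim-∩ : ∀ (a b : Subset n) → codim d (a ∩ b) ≡ codim d a + codim d b + + ∣ a ∪ b ∣ - s
  codim-∩ a b = trans (cong (λ x → s - x) ∣a∩b∣) (sym (rearrange s (+ ∣ a ∣) (+ ∣ b ∣) (+ ∣ a ∪ b ∣)))
    where
    ∣a∩b∣ : + ∣ a ∩ b ∣ ≡ + ∣ a ∣ + + ∣ b ∣ - + ∣ a ∪ b ∣
    ∣a∩b∣ = trans (add-sub (+ ∣ a ∩ b ∣) (+ ∣ a ∪ b ∣))
      (cong (_- + ∣ a ∪ b ∣) (trans (sym (ℤP.pos-+ ∣ a ∩ b ∣ ∣ a ∪ b ∣))
        (trans (cong +_ (∣p∩q∣+∣p∪q∣≡∣p∣+∣q∣ a b)) (ℤP.pos-+ ∣ a ∣ ∣ b ∣))))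
      where
      add-sub : ∀ x y → x ≡ (x + y) - y
      add-sub = solve-∀
    rearrange : ∀ s x y u → (s - x) + (s - y) + u - s ≡ s - (x + y - u)
    rearrange = solve-∀

  D-filter-split : ∀ {P : Pred (Subset n) 0ℓ} (P? : Decidable P) (U : Coll n) →
    let F = filter P? U ; G = filter (∁? P?) U in
    D d U ≡ D d F + D d G + + ∣ ⋂ F ∪ ⋂ G ∣ - s
  D-filter-split P? U =
    trans (cong₂ _-_ (trans (cong (codim d) (⋂-filter-split P? U)) (codim-∩ (⋂ F) (⋂ G)))
                     (ρ-filter-split P? U))
          (rearrange (codim d (⋂ F)) (codim d (⋂ G)) (+ ∣ ⋂ F ∪ ⋂ G ∣) s (ρ d F) (ρ d G))
    where
    F = filter P? U
    G = filter (∁? P?) U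
    rearrange : ∀ ca cb u s ra rb → (ca + cb + u - s) - (ra + rb) ≡ (ca - ra) + (cb - rb) + u - s
    rearrange = solve-∀

  D-∷ : ∀ (Y : Subset n) (V : Coll n) → D d (Y ∷ V) ≡ D d V + + ∣ Y ∪ ⋂ V ∣ - s
  D-∷ Y V = trans (cong (_- (codim d Y + ρ d V)) (codim-∩ Y (⋂ V)))
                  (rearrange (codim d Y) (codim d (⋂ V)) (+ ∣ Y ∪ ⋂ V ∣) s (ρ d V))
    where
    rearrange : ∀ cY cV u s r → (cY + cV + u - s) - (cY + r) ≡ (cV - r) + u - s
    rearrange = solve-∀

  D-singleton : ∀ (Z : Subset n) → D d [ Z ] ≡ 0ℤ
  D-singleton Z = trans (cong (λ W → codim d W - (codim d Z + 0ℤ)) (∩-identityʳ Z)) (cancel (codim d Z))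
    where
    cancel : ∀ c → c - (c + 0ℤ) ≡ 0ℤ
    cancel = solve-∀

  good⇒0≤D : ∀ (S : Coll n) → ¬ S ≡ [] → Unique S → Good S → 0ℤ ℤ.≤ D d S
  good⇒0≤D [] S≢[] _ _ = ⊥-elim (S≢[] refl)
  good⇒0≤D (X ∷ []) _ _ _ = ℤP.≤-reflexive (sym (D-singleton X))
  good⇒0≤D (X ∷ Y ∷ S) _ u g = ℤP.<⇒≤ (g _ u (All.tabulate (λ x → x)) (s≤s (s≤s z≤n)))

  codim-antitone : ∀ {X Y : Subset n} → Y ⊆ X → codim d X ℤ.≤ codim d Y
  codim-antitone Y⊆X = ℤP.+-monoʳ-≤ s (ℤP.neg-mono-≤ (ℤ.+≤+ (p⊆q⇒∣p∣≤∣q∣ Y⊆X)))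

  codim-injective : ∀ (X Y : Subset n) → codim d X ≡ codim d Y → ∣ X ∣ ≡ ∣ Y ∣
  codim-injective X Y e =
    ℤP.+-injective (trans (sub-sub s (+ ∣ X ∣)) (trans (cong (λ x → s - x) e) (sym (sub-sub s (+ ∣ Y ∣)))))
    where
    sub-sub : ∀ s x → x ≡ s - (s - x)
    sub-sub = solve-∀

  supersets-ρ-bound : ∀ (Y : Subset n) (S : Coll n) → ∣ Y ∣ ≤ d → Unique S → Good S → All (Y ⊆_) S →
    (ρ d S ℤ.≤ codim d Y) × (ρ d S ≡ codim d Y → S ≡ [ Y ])
  supersets-ρ-bound Y [] ∣Y∣≤d _ _ _ = ℤP.<⇒≤ 0<codimY , λ e → ⊥-elim (ℤP.<⇒≢ 0<codimY e)
    where
    0<codimY : 0ℤ ℤ.< codim d Y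
    0<codimY = j<i⇒0<i-j (ℤ.+<+ (s≤s ∣Y∣≤d))
  supersets-ρ-bound Y (X ∷ []) _ _ _ (Y⊆X ∷ []) =
    subst (ℤ._≤ codim d Y) (sym (ℤP.+-identityʳ _)) (codim-antitone Y⊆X) ,
    λ e → cong [_] (sym (⊆∧∣≡∣⇒≡ Y⊆X (sym (codim-injective X Y (trans (sym (ℤP.+-identityʳ _)) e)))))
  supersets-ρ-bound Y S@(_ ∷ _ ∷ _) _ u g Y⊆S = ℤP.<⇒≤ ρS<codimY , λ e → ⊥-elim (ℤP.<⇒≢ ρS<codimY e)
    where
    -- D(S) > 0 says ρ(S) < codim(⋂ S), and Y ⊆ ⋂ S.
    ρS<codimY : ρ d S ℤ.< codim d Y
    ρS<codimY = ℤP.<-≤-trans (0<i-j⇒j<i (g S u (All.tabulate (λ x → x)) (s≤s (s≤s z≤n))))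
                             (codim-antitone (⊆-⋂ S Y⊆S))

  Refines-tail : ∀ {S W Y} → Refines S (Y ∷ W) → Refines (filter (∁? (above? Y)) S) W
  Refines-tail {S} {W} {Y} r X x with ∈-filter⁻ (∁? (above? Y)) {xs = S} x
  ... | x∈S , Y⊈X with r X x∈S
  ... | Z , here refl , Z⊆X = ⊥-elim (Y⊈X Z⊆X)
  ... | Z , there z∈W , Z⊆X = Z , z∈W , Z⊆X

  refinement-ρ-bound : ∀ (W S : Coll n) → Sized W → Unique S → Good S → Refines S W →
    (ρ d S ℤ.≤ ρ d W) × (ρ d S ≡ ρ d W → S ≈C W)
  refinement-ρ-bound [] [] _ _ _ _ = ℤP.≤-refl , λ _ → ≈C-reflexive refl
  refinement-ρ-bound [] (X ∷ S) _ _ _ r with r X (here refl)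
  ... | _ , () , _
  refinement-ρ-bound (Y ∷ W) S (∣Y∣≤d ∷ sizedW) u g r =
    subst (ℤ._≤ ρ d (Y ∷ W)) (sym ρ-split) (ℤP.+-mono-≤ (proj₁ aboveY) (proj₁ rest)) , equality
    where
    ρ-split = ρ-filter-split (above? Y) S
    aboveY = supersets-ρ-bound Y (filter (above? Y) S) ∣Y∣≤d (UniqueP.filter⁺ (above? Y) u)
               (good-⊆ g (filter-⊆ (above? Y) S)) (AllP.all-filter (above? Y) S)
    rest = refinement-ρ-bound W (filter (∁? (above? Y)) S) sizedW (UniqueP.filter⁺ (∁? (above? Y)) u)
             (good-⊆ g (filter-⊆ (∁? (above? Y)) S)) (Refines-tail r)
    equality : ρ d S ≡ ρ d (Y ∷ W) → S ≈C (Y ∷ W)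
    equality e with +-tight (proj₁ aboveY) (proj₁ rest) (trans (sym ρ-split) e)
    ... | tight₁ , tight₂ =
      ≈C-trans (filter-partition (above? Y) S)
               (++-cong (≈C-reflexive (proj₂ aboveY tight₁)) (proj₂ rest tight₂))

  ≤⇒Refines : ∀ {S W : Coll n} → S ≤[ d ] W → Refines S W
  ≤⇒Refines (inj₁ (_ , r)) = r
  ≤⇒Refines (inj₂ S≈W) X x = X , proj₁ (S≈W X) x , ⊆-refl

  Refines⇒≤ : ∀ {S W : Coll n} → Sized W → InL n d S → Refines S W → S ≤[ d ] W
  Refines⇒≤ {S} {W} sizedW (u , g , _) r with refinement-ρ-bound W S sizedW u g r
  ... | ρS≤ρW , equality with ≤⇒<⊎≡ ρS≤ρW
  ... | inj₁ ρS<ρW = inj₁ (ρS<ρW , r)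
  ... | inj₂ ρS≡ρW = inj₂ (equality ρS≡ρW)

  selection : Coll n → Coll n → Coll n
  selection [] U = []
  selection (Y ∷ W) U with filter (above? Y) U
  ... | [] = selection W U
  ... | _ ∷ _ = Y ∷ selection W (filter (∁? (above? Y)) U)

  selection-⊆ : ∀ (W U : Coll n) → All (_∈ W) (selection W U)
  selection-⊆ [] U = []
  selection-⊆ (Y ∷ W) U with filter (above? Y) U
  ... | [] = All.map there (selection-⊆ W U)
  ... | _ ∷ _ = here refl ∷ All.map there (selection-⊆ W (filter (∁? (above? Y)) U))

  selection-unique : ∀ (W U : Coll n) → Unique W → Unique (selection W U)
  selection-unique [] U _ = []
  selection-unique (Y ∷ W) U (Y∉W ∷ uW) with filter (above? Y) U
  ... | [] = selection-unique W U uW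
  ... | _ ∷ _ = All.map (All.lookup Y∉W) (selection-⊆ W (filter (∁? (above? Y)) U))
                ∷ selection-unique W (filter (∁? (above? Y)) U) uW

  GroupwiseGood : Coll n → Coll n → Set
  GroupwiseGood W U = ∀ Y → Y ∈ W → Good (filter (above? Y) U)

  -- If U refines W groupwise-goodly, then U refines its selection V and
  -- D(V) ≤ D(U): splitting off the group F above the selected Y gives
  -- D(U) = D(F) + D(U ∖ F) + |⋂F ∪ ⋂(U ∖ F)| - (d+1) with D(F) ≥ 0, while
  -- D(Y ∷ V') = D(V') + |Y ∪ ⋂V'| - (d+1) and Y ∪ ⋂V' ⊆ ⋂F ∪ ⋂(U ∖ F).
  selection-bound : ∀ (W U : Coll n) → Unique U → Refines U W → GroupwiseGood W U →
    Refines U (selection W U) × (D d (selection W U) ℤ.≤ D d U)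
  selection-bound [] [] _ _ _ = (λ _ ()) , ℤP.≤-refl
  selection-bound [] (X ∷ U) _ r _ with r X (here refl)
  ... | _ , () , _
  selection-bound (Y ∷ W) U u r groupwise with filter (above? Y) U in F≡
  ... | [] = selection-bound W U u r' (λ Y' y → groupwise Y' (there y))
    where
    r' : Refines U W
    r' X x with r X x
    ... | Z , there z , Z⊆X = Z , z , Z⊆X
    ... | Z , here refl , Z⊆X with subst (X ∈_) F≡ (∈-filter⁺ (above? Y) x Z⊆X)
    ... | ()
  ... | _ ∷ _ = refines , D-decreases
    where
    F = filter (above? Y) U
    G = filter (∁? (above? Y)) U
    G⊆U = filter-⊆ (∁? (above? Y)) U
    ih = selection-bound W G (UniqueP.filter⁺ _ u) (Refines-tail r)
           (λ Y' y → good-⊆ (groupwise Y' (there y)) (λ x → let (x∈G , p) = ∈-filter⁻ (above? Y') x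
                                                            in ∈-filter⁺ (above? Y') (G⊆U x∈G) p))
    V' = selection W G
    refines : Refines U (Y ∷ V')
    refines X x with above? Y X
    ... | yes Y⊆X = Y , here refl , Y⊆X
    ... | no Y⊈X = let (Z , z , Z⊆X) = proj₁ ih X (∈-filter⁺ (∁? (above? Y)) x Y⊈X) in Z , there z , Z⊆X
    F≢[] : ¬ F ≡ []
    F≢[] e with trans (sym F≡) e
    ... | ()
    0≤DF : 0ℤ ℤ.≤ D d F
    0≤DF = good⇒0≤D F F≢[] (UniqueP.filter⁺ _ u) (groupwise Y (here refl))
    ∪-grows : ∣ Y ∪ ⋂ V' ∣ ≤ ∣ ⋂ F ∪ ⋂ G ∣
    ∪-grows = p⊆q⇒∣p∣≤∣q∣ (∪-mono (⊆-⋂ F (AllP.all-filter (above? Y) U)) (Refines⇒⋂⊆⋂ G V' (proj₁ ih)))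
    D-decreases : D d (Y ∷ V') ℤ.≤ D d U
    D-decreases = subst₂ ℤ._≤_ (sym (D-∷ Y V')) (sym (D-filter-split (above? Y) U))
                    (split-mono 0≤DF (proj₂ ih) (ℤ.+≤+ ∪-grows))

module Decomposition (n d : ℕ) (T : Coll n) (T∈L : InL n d T) (T₁ : Subset n) (T₁∈T : T₁ ∈ T) where
  open Families n d

  T' : Coll n
  T' = T ∖ T₁

  sizedT : Sized T
  sizedT = proj₂ (proj₂ T∈L)

  ∈T'⁻ : ∀ {Y} → Y ∈ T' → Y ∈ T × ¬ Y ≡ T₁
  ∈T'⁻ = ∈-filter⁻ (λ Y → ¬? (≡-dec _≟B_ Y T₁)) {xs = T}

  ∈T'⁺ : ∀ {Y} → Y ∈ T → ¬ Y ≡ T₁ → Y ∈ T'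
  ∈T'⁺ = ∈-filter⁺ (λ Y → ¬? (≡-dec _≟B_ Y T₁))

  -- Separation: two distinct members of T never lie in a common set X of
  -- size ≤ d, since D({Y, Y'}) = |Y ∪ Y'| - (d + 1) > 0 but Y ∪ Y' ⊆ X.
  separation : ∀ {X Y Y'} → ∣ X ∣ ≤ d → Y ∈ T → Y' ∈ T → ¬ Y ≡ Y' → Y ⊆ X → Y' ⊆ X → ⊥
  separation {X} {Y} {Y'} ∣X∣≤d y y' Y≢Y' Y⊆X Y'⊆X =
    ℤP.≤⇒≯ (ℤ.+≤+ ∣Y∪Y'∣≤s) (0<i-j⇒j<i (subst (0ℤ ℤ.<_) D-pair 0<D))
    where
    0<D : 0ℤ ℤ.< D d (Y ∷ Y' ∷ [])
    0<D = proj₁ (proj₂ T∈L) (Y ∷ Y' ∷ []) ((Y≢Y' ∷ []) ∷ [] ∷ []) (y ∷ y' ∷ []) (s≤s (s≤s z≤n))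
    D-pair : D d (Y ∷ Y' ∷ []) ≡ + ∣ Y ∪ ⋂ [ Y' ] ∣ - s
    D-pair = trans (D-∷ Y [ Y' ]) (trans (cong (λ D' → D' + + ∣ Y ∪ ⋂ [ Y' ] ∣ - s) (D-singleton Y'))
                                         (cong (_- s) (ℤP.+-identityˡ (+ ∣ Y ∪ ⋂ [ Y' ] ∣))))
    ∣Y∪Y'∣≤s : ∣ Y ∪ ⋂ [ Y' ] ∣ ≤ suc d
    ∣Y∪Y'∣≤s = ℕP.m≤n⇒m≤1+n (ℕP.≤-trans (p⊆q⇒∣p∣≤∣q∣ (∪-least Y⊆X (⊆-trans (p∩q⊆p Y' ⊤) Y'⊆X))) ∣X∣≤d)

  only-T₁-below : ∀ {X Y} → ∣ X ∣ ≤ d → T₁ ⊆ X → Y ∈ T → Y ⊆ X → Y ≡ T₁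
  only-T₁-below ∣X∣≤d T₁⊆X y Y⊆X with ≡-dec _≟B_ _ T₁
  ... | yes Y≡T₁ = Y≡T₁
  ... | no Y≢T₁ = ⊥-elim (separation ∣X∣≤d y T₁∈T Y≢T₁ Y⊆X T₁⊆X)

  ≤T₁⇒above : ∀ {S₁ X} → S₁ ≤[ d ] [ T₁ ] → X ∈ S₁ → T₁ ⊆ X
  ≤T₁⇒above S₁≤ x with ≤⇒Refines S₁≤ _ x
  ... | _ , here refl , T₁⊆X = T₁⊆X

  ≤T'⇒not-above : ∀ {S₂ X} → Sized S₂ → S₂ ≤[ d ] T' → X ∈ S₂ → ¬ T₁ ⊆ X
  ≤T'⇒not-above sized S₂≤ x T₁⊆X with ≤⇒Refines S₂≤ _ x
  ... | Y , y , Y⊆X = proj₂ (∈T'⁻ y) (only-T₁-below (All.lookup sized x) T₁⊆X (proj₁ (∈T'⁻ y)) Y⊆X)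

  module Union {S₁ S₂ : Coll n} (S₁∈L : InL n d S₁) (S₁≤ : S₁ ≤[ d ] [ T₁ ])
                                (S₂∈L : InL n d S₂) (S₂≤ : S₂ ≤[ d ] T') where
    sized : Sized (S₁ ++ S₂)
    sized = AllP.++⁺ (proj₂ (proj₂ S₁∈L)) (proj₂ (proj₂ S₂∈L))

    S₂-not-above : ∀ {X} → X ∈ S₂ → ¬ T₁ ⊆ X
    S₂-not-above = ≤T'⇒not-above (proj₂ (proj₂ S₂∈L)) S₂≤

    unique : Unique (S₁ ++ S₂)
    unique = UniqueP.++⁺ (proj₁ S₁∈L) (proj₁ S₂∈L) (λ (x₁ , x₂) → S₂-not-above x₂ (≤T₁⇒above S₁≤ x₁))

    refines-T : Refines (S₁ ++ S₂) T
    refines-T X x with ∈-++⁻ S₁ x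
    ... | inj₁ x∈S₁ = T₁ , T₁∈T , ≤T₁⇒above S₁≤ x∈S₁
    ... | inj₂ x∈S₂ = let (Y , y , Y⊆X) = ≤⇒Refines S₂≤ X x∈S₂ in Y , proj₁ (∈T'⁻ y) , Y⊆X

    above⇒S₁ : ∀ {X} → X ∈ S₁ ++ S₂ → T₁ ⊆ X → X ∈ S₁
    above⇒S₁ x T₁⊆X with ∈-++⁻ S₁ x
    ... | inj₁ x∈S₁ = x∈S₁
    ... | inj₂ x∈S₂ = ⊥-elim (S₂-not-above x∈S₂ T₁⊆X)

    not-above⇒S₂ : ∀ {X} → X ∈ S₁ ++ S₂ → ¬ T₁ ⊆ X → X ∈ S₂
    not-above⇒S₂ x T₁⊈X with ∈-++⁻ S₁ x
    ... | inj₁ x∈S₁ = ⊥-elim (T₁⊈X (≤T₁⇒above S₁≤ x∈S₁))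
    ... | inj₂ x∈S₂ = x∈S₂

    -- A subfamily U with a member X above T₁ and a member X' not above T₁
    -- has D(U) ≥ D(V) > 0 for its selection V ⊆ T, since V contains T₁
    -- (below X) and a different member (below X').
    mixed-good : ∀ (U : Coll n) → Unique U → All (_∈ S₁ ++ S₂) U →
      ∀ {X X'} → X ∈ U → T₁ ⊆ X → X' ∈ U → ¬ T₁ ⊆ X' → 0ℤ ℤ.< D d U
    mixed-good U u U⊆ {X} {X'} x T₁⊆X x' T₁⊈X' = ℤP.<-≤-trans 0<DV (proj₂ selected)
      where
      ∣_∣≤d : ∀ {Z} → Z ∈ U → ∣ Z ∣ ≤ d
      ∣ z ∣≤d = All.lookup sized (All.lookup U⊆ z)
      groupwise : GroupwiseGood T U
      groupwise Y y with ≡-dec _≟B_ Y T₁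
      ... | yes refl = good-⊆ (proj₁ (proj₂ S₁∈L)) λ z →
        let (z∈U , T₁⊆Z) = ∈-filter⁻ (above? T₁) z in above⇒S₁ (All.lookup U⊆ z∈U) T₁⊆Z
      ... | no Y≢T₁ = good-⊆ (proj₁ (proj₂ S₂∈L)) λ z →
        let (z∈U , Y⊆Z) = ∈-filter⁻ (above? Y) z
        in not-above⇒S₂ (All.lookup U⊆ z∈U) (λ T₁⊆Z → Y≢T₁ (only-T₁-below ∣ z∈U ∣≤d T₁⊆Z y Y⊆Z))
      selected = selection-bound T U u (λ Z z → refines-T Z (All.lookup U⊆ z)) groupwise
      V⊆T = selection-⊆ T U
      0<DV : 0ℤ ℤ.< D d (selection T U)
      0<DV with proj₁ selected X x | proj₁ selected X' x'
      ... | Y , y , Y⊆X | Y' , y' , Y'⊆X' =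
        proj₁ (proj₂ T∈L) _ (selection-unique T U (proj₁ T∈L)) V⊆T (distinct∈⇒2≤length y y' Y≢Y')
        where
        Y≡T₁ : Y ≡ T₁
        Y≡T₁ = only-T₁-below ∣ x ∣≤d T₁⊆X (All.lookup V⊆T y) Y⊆X
        Y≢Y' : ¬ Y ≡ Y'
        Y≢Y' Y≡Y' = T₁⊈X' (subst (_⊆ X') (trans (sym Y≡Y') Y≡T₁) Y'⊆X')

    good : Good (S₁ ++ S₂)
    good U u U⊆ len with trichotomy (above? T₁) U
    ... | inj₁ allAbove = proj₁ (proj₂ S₁∈L) U u (All.zipWith {Q = T₁ ⊆_} in-S₁ (U⊆ , allAbove)) len
      where
      in-S₁ : ∀ {X} → X ∈ S₁ ++ S₂ × T₁ ⊆ X → X ∈ S₁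
      in-S₁ (x , T₁⊆X) = above⇒S₁ x T₁⊆X
    ... | inj₂ (inj₁ noneAbove) = proj₁ (proj₂ S₂∈L) U u (All.zipWith {Q = λ X → ¬ T₁ ⊆ X} in-S₂ (U⊆ , noneAbove)) len
      where
      in-S₂ : ∀ {X} → X ∈ S₁ ++ S₂ × ¬ T₁ ⊆ X → X ∈ S₂
      in-S₂ (x , T₁⊈X) = not-above⇒S₂ x T₁⊈X
    ... | inj₂ (inj₂ ((_ , x , T₁⊆X) , (_ , x' , T₁⊈X'))) = mixed-good U u U⊆ x T₁⊆X x' T₁⊈X'

    ∈L : InL n d (S₁ ++ S₂)
    ∈L = unique , good , sized

    ≤T : (S₁ ++ S₂) ≤[ d ] T
    ≤T = Refines⇒≤ sizedT ∈L refines-T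

  P Q : PosetData
  P = Ipd n d [ T₁ ] ×P Ipd n d T'
  Q = Ipd n d T
  open PosetData P using () renaming (Car to Pair; _≈_ to _≈ᴾ_; _≤_ to _≤ᴾ_)
  open PosetData Q using () renaming (_≈_ to _≈ᴵ_; _≤_ to _≤ᴵ_)

  merge : Pair → I n d T
  merge ((S₁ , S₁∈L , S₁≤) , (S₂ , S₂∈L , S₂≤)) = S₁ ++ S₂ , ∈L , ≤T
    where open Union S₁∈L S₁≤ S₂∈L S₂≤

  above-part-≤ : ∀ {S} → InL n d S → filter (above? T₁) S ≤[ d ] [ T₁ ]
  above-part-≤ {S} S∈L = Refines⇒≤ (All.lookup sizedT T₁∈T ∷ []) (InL-filter (above? T₁) S∈L)
    λ X x → T₁ , here refl , proj₂ (∈-filter⁻ (above? T₁) {xs = S} x)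

  rest-part-≤ : ∀ {S} → InL n d S → S ≤[ d ] T → filter (∁? (above? T₁)) S ≤[ d ] T'
  rest-part-≤ {S} S∈L S≤T = Refines⇒≤ (AllP.filter⁺ _ sizedT) (InL-filter (∁? (above? T₁)) S∈L) refines-T'
    where
    refines-T' : Refines (filter (∁? (above? T₁)) S) T'
    refines-T' X x with ∈-filter⁻ (∁? (above? T₁)) x
    ... | x∈S , T₁⊈X with ≤⇒Refines S≤T X x∈S
    ... | Y , y , Y⊆X = Y , ∈T'⁺ y (λ Y≡T₁ → T₁⊈X (subst (_⊆ X) Y≡T₁ Y⊆X)) , Y⊆X

  split : I n d T → Pair
  split (S , S∈L , S≤T) =
    (filter (above? T₁) S , InL-filter (above? T₁) S∈L , above-part-≤ S∈L) ,
    (filter (∁? (above? T₁)) S , InL-filter (∁? (above? T₁)) S∈L , rest-part-≤ S∈L S≤T)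

  merge-cong : ∀ {a a'} → a ≈ᴾ a' → merge a ≈ᴵ merge a'
  merge-cong {_ , _} {_ , _} (S₁≈ , S₂≈) = ++-cong S₁≈ S₂≈

  split-cong : ∀ {b b'} → b ≈ᴵ b' → split b ≈ᴾ split b'
  split-cong S≈ = filter-cong (above? T₁) S≈ , filter-cong (∁? (above? T₁)) S≈

  split∘merge : ∀ a → split (merge a) ≈ᴾ a
  split∘merge ((S₁ , S₁∈L , S₁≤) , (S₂ , S₂∈L , S₂≤)) =
    (λ X → (λ x → let (x∈ , T₁⊆X) = ∈-filter⁻ (above? T₁) x in above⇒S₁ x∈ T₁⊆X) ,
           (λ x → ∈-filter⁺ (above? T₁) (∈-++⁺ˡ x) (≤T₁⇒above S₁≤ x))) ,
    (λ X → (λ x → let (x∈ , T₁⊈X) = ∈-filter⁻ (∁? (above? T₁)) x in not-above⇒S₂ x∈ T₁⊈X) ,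
           (λ x → ∈-filter⁺ (∁? (above? T₁)) (∈-++⁺ʳ S₁ x) (S₂-not-above x)))
    where open Union S₁∈L S₁≤ S₂∈L S₂≤

  merge∘split : ∀ b → merge (split b) ≈ᴵ b
  merge∘split (S , _) = ≈C-sym (filter-partition (above? T₁) S)

  merge-mono : ∀ {a a'} → a ≤ᴾ a' → merge a ≤ᴵ merge a'
  merge-mono {(_ , S₁∈L , S₁≤) , (_ , S₂∈L , S₂≤)} {(_ , S₁'∈L , S₁'≤) , (_ , S₂'∈L , S₂'≤)}
             (S₁≤S₁' , S₂≤S₂') =
    Refines⇒≤ (Union.sized S₁'∈L S₁'≤ S₂'∈L S₂'≤) (Union.∈L S₁∈L S₁≤ S₂∈L S₂≤)
              (Refines-++ (≤⇒Refines S₁≤S₁') (≤⇒Refines S₂≤S₂'))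

  -- A member of S₁ (above T₁) can only be refined by a member of S₁', since a
  -- member of S₂' lies above some member of T' that would be below it with T₁;
  -- a member of S₂ (not above T₁) cannot lie above a member of S₁'.
  merge-reflect : ∀ {a a'} → merge a ≤ᴵ merge a' → a ≤ᴾ a'
  merge-reflect {(S₁ , S₁∈L , S₁≤) , (S₂ , S₂∈L , S₂≤)} {(S₁' , S₁'∈L , S₁'≤) , (S₂' , S₂'∈L , S₂'≤)} S≤S' =
    Refines⇒≤ (proj₂ (proj₂ S₁'∈L)) S₁∈L refines₁ , Refines⇒≤ (proj₂ (proj₂ S₂'∈L)) S₂∈L refines₂
    where
    refines : Refines (S₁ ++ S₂) (S₁' ++ S₂')
    refines = ≤⇒Refines S≤S'
    refines₁ : Refines S₁ S₁'
    refines₁ X x with refines X (∈-++⁺ˡ x)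
    ... | Y , y , Y⊆X with ∈-++⁻ S₁' y
    ...   | inj₁ y∈S₁' = Y , y∈S₁' , Y⊆X
    ...   | inj₂ y∈S₂' with ≤⇒Refines S₂'≤ Y y∈S₂'
    ...     | Z , z , Z⊆Y = ⊥-elim (proj₂ (∈T'⁻ z) (only-T₁-below (All.lookup (proj₂ (proj₂ S₁∈L)) x)
                                      (≤T₁⇒above S₁≤ x) (proj₁ (∈T'⁻ z)) (⊆-trans Z⊆Y Y⊆X)))
    refines₂ : Refines S₂ S₂'
    refines₂ X x with refines X (∈-++⁺ʳ S₁ x)
    ... | Y , y , Y⊆X with ∈-++⁻ S₁' y
    ...   | inj₁ y∈S₁' = ⊥-elim (Union.S₂-not-above S₁∈L S₁≤ S₂∈L S₂≤ x (⊆-trans (≤T₁⇒above S₁'≤ y∈S₁') Y⊆X))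
    ...   | inj₂ y∈S₂' = Y , y∈S₂' , Y⊆X

lemma3p6 : (n d : ℕ) → 1 ≤ d → d < n → (T : Coll n) → InL n d T →
    (T₁ : Subset n) → T₁ ∈ T →
    PosetIso (Ipd n d [ T₁ ] ×P Ipd n d (T ∖ T₁)) (Ipd n d T)
lemma3p6 n d _ _ T T∈L T₁ T₁∈T = record
  { to         = merge
  ; from       = split
  ; to-cong    = λ {a} {a'} → merge-cong {a} {a'}
  ; from-cong  = λ {a} {a'} → split-cong {a} {a'}
  ; from∘to    = split∘merge
  ; to∘from    = merge∘split
  ; to-mono    = λ {a} {a'} → merge-mono {a} {a'}
  ; to-reflect = λ {a} {a'} → merge-reflect {a} {a'}
  }
  where open Decomposition n d T T∈L T₁ T₁∈T
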